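{- For all incidence hypergraphs $G,H$ there are isomorphisms $\left(G\blacksquare H\right)^{\#}\cong G^{\#}\blacksquare H\cong G\blacksquare H^{\#}$ of incidence hypergraphs, natural in $G$ and $H$.
   Context: An incidence hypergraph $G$ consists of sets $\check V(G)$, $\check E(G)$, $I(G)$ and functions $\varsigma_G:I(G)\to\check V(G)$, $\omega_G:I(G)\to\check E(G)$; a homomorphism $\phi:G\to H$ is a triple of functions $\check V(\phi),\check E(\phi),I(\phi)$ with $\varsigma_H\circ I(\phi)=\check V(\phi)\circ\varsigma_G$, $\omega_H\circ I(\phi)=\check E(\phi)\circ\omega_G$. The incidence dual is $G^\#:=(\check E(G),\check V(G),I(G),\omega_G,\varsigma_G)$ (vertices and edges swapped, $\varsigma$ and $\omega$ swapped), $\phi^\#=(\check E(\phi),\check V(\phi),I(\phi))$. Laplacian product: $\check V(G\blacksquare H)=(\{1\}\times\check V(G)\times\check V(H))\cup(\{4\}\times\check E(G)\times\check E(H))$, $\check E(G\blacksquare H)=(\{2\}\times\check E(G)\times\check V(H))\cup(\{3\}\times\check V(G)\times\check E(H))$, $I(G\blacksquare H)=(\{1\}\times I(G)\times\check V(H))\cup(\{2\}\times I(G)\times\check E(H))\cup(\{3\}\times\check E(G)\times I(H))\cup(\{4\}\times\check V(G)\times I(H))$, with $\varsigma(1,x,y)=(1,\varsigma_G(x),y)$, $\varsigma(2,x,y)=(4,\omega_G(x),y)$, $\varsigma(3,x,y)=(4,x,\omega_H(y))$, $\varsigma(4,x,y)=(1,x,\varsigma_H(y))$, $\omega(1,x,y)=(2,\omega_G(x),y)$,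 $\omega(2,x,y)=(3,\varsigma_G(x),y)$, $\omega(3,x,y)=(2,x,\varsigma_H(y))$, $\omega(4,x,y)=(3,x,\omega_H(y))$. On morphisms $\phi\blacksquare\psi$ acts componentwise: vertices $(1,x,y)\mapsto(1,\check V\phi(x),\check V\psi(y))$, $(4,x,y)\mapsto(4,\check E\phi(x),\check E\psi(y))$; edges $(2,x,y)\mapsto(2,\check E\phi(x),\check V\psi(y))$, $(3,x,y)\mapsto(3,\check V\phi(x),\check E\psi(y))$; incidences $(1,x,y)\mapsto(1,I\phi(x),\check V\psi(y))$, $(2,x,y)\mapsto(2,I\phi(x),\check E\psi(y))$, $(3,x,y)\mapsto(3,\check E\phi(x),I\psi(y))$, $(4,x,y)\mapsto(4,\check V\phi(x),I\psi(y))$. -}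

module Defs where

open import Relation.Binary.PropositionalEquality using (_≡_; refl; trans; cong)
open import Data.Product using (Σ; _×_; _,_)

record IncHyp : Set₁ where
  field
    V : Set
    E : Set
    I : Set
    ς : I → V
    ω : I → E
open IncHyp public

record Hom (G H : IncHyp) : Set where
  field
    fV : V G → V H
    fE : E G → E H
    fI : I G → I H
    ς-comm : ∀ i → ς H (fI i) ≡ fV (ς G i)
    ω-comm : ∀ i → ω H (fI i) ≡ fE (ω G i)
open Hom public

-- equality of homomorphisms: equality of the three underlying functions
-- (pointwise, since function extensionality is not available)
_≈H_ : {G H : IncHyp} → Hom G H → Hom G H → Set
φ ≈H ψ = (∀ v → fV φ v ≡ fV ψ v) × (∀ e → fE φ e ≡ fE ψ e) × (∀ i → fI φ i ≡ fI ψ i)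

idH : (G : IncHyp) → Hom G G
idH G = record { fV = λ x → x ; fE = λ x → x ; fI = λ x → x
               ; ς-comm = λ _ → refl ; ω-comm = λ _ → refl }

_∘H_ : {G H K : IncHyp} → Hom H K → Hom G H → Hom G K
_∘H_ {G} {H} {K} ψ φ = record
  { fV = λ x → fV ψ (fV φ x)
  ; fE = λ x → fE ψ (fE φ x)
  ; fI = λ x → fI ψ (fI φ x)
  ; ς-comm = λ i → trans (ς-comm ψ (fI φ i)) (cong (fV ψ) (ς-comm φ i))
  ; ω-comm = λ i → trans (ω-comm ψ (fI φ i)) (cong (fE ψ) (ω-comm φ i))
  }

record Iso (G H : IncHyp) : Set where
  field
    to   : Hom G H
    from : Hom H G
    from∘to : (from ∘H to) ≈H idH G
    to∘from : (to ∘H from) ≈H idH H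
open Iso public

_# : IncHyp → IncHyp
G # = record { V = E G ; E = V G ; I = I G ; ς = ω G ; ω = ς G }

_#ʰ : {G H : IncHyp} → Hom G H → Hom (G #) (H #)
φ #ʰ = record { fV = fE φ ; fE = fV φ ; fI = fI φ
              ; ς-comm = ω-comm φ ; ω-comm = ς-comm φ }

-- Laplacian product  G ■ H  (constructor tags 1..4 as in the paper)

data PV (G H : IncHyp) : Set where
  v1 : V G → V H → PV G H
  v4 : E G → E H → PV G H

data PE (G H : IncHyp) : Set where
  e2 : E G → V H → PE G H
  e3 : V G → E H → PE G H

data PI (G H : IncHyp) : Set where
  i1 : I G → V H → PI G H
  i2 : I G → E H → PI G H
  i3 : E G → I H → PI G H
  i4 : V G → I H → PI G H

Pς : (G H : IncHyp) → PI G H → PV G H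
Pς G H (i1 x y) = v1 (ς G x) y
Pς G H (i2 x y) = v4 (ω G x) y
Pς G H (i3 x y) = v4 x (ω H y)
Pς G H (i4 x y) = v1 x (ς H y)

Pω : (G H : IncHyp) → PI G H → PE G H
Pω G H (i1 x y) = e2 (ω G x) y
Pω G H (i2 x y) = e3 (ς G x) y
Pω G H (i3 x y) = e2 x (ς H y)
Pω G H (i4 x y) = e3 x (ω H y)

_■_ : IncHyp → IncHyp → IncHyp
G ■ H = record { V = PV G H ; E = PE G H ; I = PI G H ; ς = Pς G H ; ω = Pω G H }

module _ {G G' H H' : IncHyp} (φ : Hom G G') (ψ : Hom H H') where
  private
    mV : PV G H → PV G' H'
    mV (v1 x y) = v1 (fV φ x) (fV ψ y)
    mV (v4 x y) = v4 (fE φ x) (fE ψ y)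

    mE : PE G H → PE G' H'
    mE (e2 x y) = e2 (fE φ x) (fV ψ y)
    mE (e3 x y) = e3 (fV φ x) (fE ψ y)

    mI : PI G H → PI G' H'
    mI (i1 x y) = i1 (fI φ x) (fV ψ y)
    mI (i2 x y) = i2 (fI φ x) (fE ψ y)
    mI (i3 x y) = i3 (fE φ x) (fI ψ y)
    mI (i4 x y) = i4 (fV φ x) (fI ψ y)

    cong₂' : ∀ {A B C : Set} (f : A → B → C) {a a' b b'} → a ≡ a' → b ≡ b' → f a b ≡ f a' b'
    cong₂' f refl refl = refl

    mς : ∀ i → Pς G' H' (mI i) ≡ mV (Pς G H i)
    mς (i1 x y) = cong₂' v1 (ς-comm φ x) refl
    mς (i2 x y) = cong₂' v4 (ω-comm φ x) refl
    mς (i3 x y) = cong₂' v4 refl (ω-comm ψ y)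
    mς (i4 x y) = cong₂' v1 refl (ς-comm ψ y)

    mω : ∀ i → Pω G' H' (mI i) ≡ mE (Pω G H i)
    mω (i1 x y) = cong₂' e2 (ω-comm φ x) refl
    mω (i2 x y) = cong₂' e3 (ς-comm φ x) refl
    mω (i3 x y) = cong₂' e2 refl (ς-comm ψ y)
    mω (i4 x y) = cong₂' e3 refl (ω-comm ψ y)

  _■ʰ_ : Hom (G ■ H) (G' ■ H')
  _■ʰ_ = record { fV = mV ; fE = mE ; fI = mI ; ς-comm = mς ; ω-comm = mω }

NaturalIso :
  (F₀ : IncHyp → IncHyp → IncHyp)
  (F₁ : ∀ {G G' H H'} → Hom G G' → Hom H H' → Hom (F₀ G H) (F₀ G' H'))
  (K₀ : IncHyp → IncHyp → IncHyp)
  (K₁ : ∀ {G G' H H'} → Hom G G' → Hom H H' → Hom (K₀ G H) (K₀ G' H')) →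
  Set₁
NaturalIso F₀ F₁ K₀ K₁ =
  Σ ((G H : IncHyp) → Iso (F₀ G H) (K₀ G H)) λ α →
    ∀ {G G' H H'} (φ : Hom G G') (ψ : Hom H H') →
      (to (α G' H') ∘H F₁ φ ψ) ≈H (K₁ φ ψ ∘H to (α G H))

{-# OPTIONS --safe #-}
module Submission where

-- Dualising G ■ H is a relabelling: the vertices of (G ■ H) #, i.e. the
-- tag-2/3 edges of G ■ H, are the tag-1/4 vertices of G # ■ H and vice versa,
-- while incidence tags 3 and 4 trade places.  As ■ is symmetric (swap the factors and tags 1 ↔ 4, 2 ↔ 3),
-- the second isomorphism is (G ■ H) # ≅ (H ■ G) # ≅ H # ■ G ≅ G ■ H #.
-- Every map is a relabelling, so all equations hold by computation once an
-- element is split by its tag.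

open import Defs
open import Data.Product using (_×_; _,_)
open import Relation.Binary.PropositionalEquality using (_≡_; refl)

■-swap : (G H : IncHyp) → Hom (G ■ H) (H ■ G)
■-swap G H = record { fV = swapV ; fE = swapE ; fI = swapI ; ς-comm = swap-ς ; ω-comm = swap-ω }
  where
  swapV : PV G H → PV H G
  swapV (v1 x y) = v1 y x
  swapV (v4 x y) = v4 y x

  swapE : PE G H → PE H G
  swapE (e2 x y) = e3 y x
  swapE (e3 x y) = e2 y x

  swapI : PI G H → PI H G
  swapI (i1 x y) = i4 y x
  swapI (i2 x y) = i3 y x
  swapI (i3 x y) = i2 y x
  swapI (i4 x y) = i1 y x

  swap-ς : ∀ i → Pς H G (swapI i) ≡ swapV (Pς G H i)
  swap-ς (i1 x y) = refl
  swap-ς (i2 x y) = refl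
  swap-ς (i3 x y) = refl
  swap-ς (i4 x y) = refl

  swap-ω : ∀ i → Pω H G (swapI i) ≡ swapE (Pω G H i)
  swap-ω (i1 x y) = refl
  swap-ω (i2 x y) = refl
  swap-ω (i3 x y) = refl
  swap-ω (i4 x y) = refl

■-dualˡ : (G H : IncHyp) → Hom ((G ■ H) #) ((G #) ■ H)
■-dualˡ G H = record { fV = dualV ; fE = dualE ; fI = dualI ; ς-comm = dual-ς ; ω-comm = dual-ω }
  where
  dualV : PE G H → PV (G #) H
  dualV (e2 x y) = v1 x y
  dualV (e3 x y) = v4 x y

  dualE : PV G H → PE (G #) H
  dualE (v1 x y) = e2 x y
  dualE (v4 x y) = e3 x y

  dualI : PI G H → PI (G #) H
  dualI (i1 x y) = i1 x y
  dualI (i2 x y) = i2 x y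
  dualI (i3 x y) = i4 x y
  dualI (i4 x y) = i3 x y

  dual-ς : ∀ i → Pς (G #) H (dualI i) ≡ dualV (Pω G H i)
  dual-ς (i1 x y) = refl
  dual-ς (i2 x y) = refl
  dual-ς (i3 x y) = refl
  dual-ς (i4 x y) = refl

  dual-ω : ∀ i → Pω (G #) H (dualI i) ≡ dualE (Pς G H i)
  dual-ω (i1 x y) = refl
  dual-ω (i2 x y) = refl
  dual-ω (i3 x y) = refl
  dual-ω (i4 x y) = refl

■-dualˡ-iso : (G H : IncHyp) → Iso ((G ■ H) #) ((G #) ■ H)
■-dualˡ-iso G H = record
  { to      = ■-dualˡ G H
  -- G # # is G up to record η, so the dual of the map at G # runs backwards.
  ; from    = ■-dualˡ (G #) H #ʰ
  ; from∘to = (λ { (e2 x y) → refl ; (e3 x y) → refl }) ,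
              (λ { (v1 x y) → refl ; (v4 x y) → refl }) ,
              (λ { (i1 x y) → refl ; (i2 x y) → refl ; (i3 x y) → refl ; (i4 x y) → refl })
  ; to∘from = (λ { (v1 x y) → refl ; (v4 x y) → refl }) ,
              (λ { (e2 x y) → refl ; (e3 x y) → refl }) ,
              (λ { (i1 x y) → refl ; (i2 x y) → refl ; (i3 x y) → refl ; (i4 x y) → refl })
  }

■-dualʳ : (G H : IncHyp) → Hom ((G ■ H) #) (G ■ (H #))
■-dualʳ G H = ■-swap (H #) G ∘H (■-dualˡ H G ∘H (■-swap G H #ʰ))

■-dualʳ-iso : (G H : IncHyp) → Iso ((G ■ H) #) (G ■ (H #))
■-dualʳ-iso G H = record
  { to      = ■-dualʳ G H
  ; from    = ■-dualʳ G (H #) #ʰ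
  ; from∘to = (λ { (e2 x y) → refl ; (e3 x y) → refl }) ,
              (λ { (v1 x y) → refl ; (v4 x y) → refl }) ,
              (λ { (i1 x y) → refl ; (i2 x y) → refl ; (i3 x y) → refl ; (i4 x y) → refl })
  ; to∘from = (λ { (v1 x y) → refl ; (v4 x y) → refl }) ,
              (λ { (e2 x y) → refl ; (e3 x y) → refl }) ,
              (λ { (i1 x y) → refl ; (i2 x y) → refl ; (i3 x y) → refl ; (i4 x y) → refl })
  }

module _ {G G₂ H H₂ : IncHyp} (φ : Hom G G₂) (ψ : Hom H H₂) where

  ■-dualˡ-natural : (■-dualˡ G₂ H₂ ∘H ((φ ■ʰ ψ) #ʰ)) ≈H (((φ #ʰ) ■ʰ ψ) ∘H ■-dualˡ G H)
  ■-dualˡ-natural =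
    (λ { (e2 x y) → refl ; (e3 x y) → refl }) ,
    (λ { (v1 x y) → refl ; (v4 x y) → refl }) ,
    (λ { (i1 x y) → refl ; (i2 x y) → refl ; (i3 x y) → refl ; (i4 x y) → refl })

  ■-dualʳ-natural : (■-dualʳ G₂ H₂ ∘H ((φ ■ʰ ψ) #ʰ)) ≈H ((φ ■ʰ (ψ #ʰ)) ∘H ■-dualʳ G H)
  ■-dualʳ-natural =
    (λ { (e2 x y) → refl ; (e3 x y) → refl }) ,
    (λ { (v1 x y) → refl ; (v4 x y) → refl }) ,
    (λ { (i1 x y) → refl ; (i2 x y) → refl ; (i3 x y) → refl ; (i4 x y) → refl })

mainTheorem2 : NaturalIso (λ G H → (G ■ H) #) (λ φ ψ → (φ ■ʰ ψ) #ʰ)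
    (λ G H → (G #) ■ H) (λ φ ψ → (φ #ʰ) ■ʰ ψ)
    ×
    NaturalIso (λ G H → (G ■ H) #) (λ φ ψ → (φ ■ʰ ψ) #ʰ)
    (λ G H → G ■ (H #)) (λ φ ψ → φ ■ʰ (ψ #ʰ))
mainTheorem2 = (■-dualˡ-iso , ■-dualˡ-natural) , (■-dualʳ-iso , ■-dualʳ-natural)
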